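{- Let $\theta = 82+\sqrt{6697}$ and $\overline\theta = 82 - \sqrt{6697}$ (the roots of $t^2-164t+27$), and write $D_k = \theta^k - \overline\theta^k$ and $S_k = \theta^k+\overline\theta^k$. Then for every integer $k\ge 0$: \begin{align*} E(5k+4,5k+4) &= \tfrac{3025}{2\sqrt{6697}} D_k + \tfrac{37}{2} S_k,\\ E(5k+4,5k+3) &= \tfrac{1883}{2\sqrt{6697}} D_k + \tfrac{23}{2} S_k,\\ E(5k+3,5k+3) &= \tfrac{571}{\sqrt{6697}} D_k + 7 S_k,\\ E(5k+3,5k+2) &= \tfrac{741}{2\sqrt{6697}} D_k + \tfrac{9}{2} S_k,\\ E(5k+3,5k+1) &= \tfrac{170}{\sqrt{6697}} D_k + 2 S_k,\\ E(5k+2,5k+2) &= \tfrac{401}{2\sqrt{6697}} D_k + \tfrac{5}{2} S_k,\\ E(5k+2,5k+1) &= \tfrac{247}{2\sqrt{6697}} D_k + \tfrac{3}{2} S_k,\\ E(5k+1,5k+1) &= \tfrac{77}{\sqrt{6697}} D_k + S_k,\\ E(5k+1,5k) &= \tfrac{93}{2\sqrt{6697}} D_k + \tfrac{1}{2} S_k,\\ E(5k,5k+1) &= \tfrac{61}{2\sqrt{6697}} D_k + \tfrac{1}{2} S_k, \end{align*} and for every integer $k \ge 1$: \begin{align*} E(5k,5k) &= \tfrac{77}{3\sqrt{6697}} D_k + \tfrac{1}{3} S_k,\\ E(5k,5k-1) &= \tfrac{125}{6\sqrt{6697}} D_k + \tfrac{1}{6} S_k,\\ E(5k,5k-2) &=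 \tfrac{16}{\sqrt{6697}} D_k. \end{align*}
   Context: Let $\mathcal P_\infty$ be the poset whose elements are two infinite chains $a_1<a_2<a_3<\cdots$ and $b_1<b_2<b_3<\cdots$, whose order is generated (by transitivity) by these chain relations together with the additional covering relations: $a_i \le b_{i+1}$ whenever $i \equiv 1,2,3,4 \pmod 5$, and $b_j \le a_{j+2}$ whenever $j \equiv 0,2,4 \pmod 5$. For positive integers $m,n$, $\mathcal P(m,n)$ is the subposet of $\mathcal P_\infty$ induced on $\{a_1,\dots,a_m,b_1,\dots,b_n\}$ (with the order inherited from $\mathcal P_\infty$), and $E(m,n)$ is the number of linear extensions of $\mathcal P(m,n)$; by convention $E(0,n)=E(m,0)=1$ for positive integers $m,n$, and $E(0,0)$ is undefined. -}

module Defs where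

open import Data.Nat using (ℕ; zero; suc; _+_; _%_; _≤_)
open import Data.Integer as ℤ using (ℤ; +_)
open import Data.Fin using (Fin; toℕ)
open import Data.List using (List; _++_; applyUpTo; length; lookup)
open import Data.List.Relation.Unary.All using (All)
open import Data.List.Relation.Unary.Unique.Propositional using (Unique)
open import Data.List.Relation.Binary.Permutation.Propositional using (_↭_)
open import Data.List.Membership.Propositional using (_∈_)
open import Data.Sum using (_⊎_)
open import Relation.Binary.PropositionalEquality using (_≡_; _≢_)
open import Relation.Binary.Construct.Closure.ReflexiveTransitive using (Star)

-- The poset P∞.  `a i` stands for a_i and `b j` for b_j (indices i, j ≥ 1;
-- elements with index 0 are not part of P∞ and are never reachable
-- from elements of P∞, since every generator requires index ≥ 1).

data El : Set where
  a : ℕ → El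
  b : ℕ → El

data Gen : El → El → Set where
  chainA : ∀ {i} → 1 ≤ i → Gen (a i) (a (suc i))
  chainB : ∀ {j} → 1 ≤ j → Gen (b j) (b (suc j))
  a≤b    : ∀ {i} → 1 ≤ i → i % 5 ≢ 0 → Gen (a i) (b (suc i))
  b≤a    : ∀ {j} → 1 ≤ j → (j % 5 ≡ 0 ⊎ j % 5 ≡ 2 ⊎ j % 5 ≡ 4) →
           Gen (b j) (a (j + 2))

_≼_ : El → El → Set
x ≼ y = Star Gen x y

elems : ℕ → ℕ → List El
elems m n = applyUpTo (λ i → a (suc i)) m ++ applyUpTo (λ j → b (suc j)) n

-- A linear extension of P(m,n), written as the list of its elements in
-- increasing order: a permutation of the elements of P(m,n) such that
-- whenever the element at position i is ≼ the one at position j, i ≤ j.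
record IsLinExt (m n : ℕ) (v : List El) : Set where
  field
    perm      : v ↭ elems m n
    respects  : ∀ (i j : Fin (length v)) →
                lookup v i ≼ lookup v j → toℕ i ≤ toℕ j

record NumLinExt (m n e : ℕ) : Set where
  field
    exts     : List (List El)
    sound    : All (IsLinExt m n) exts
    distinct : Unique exts
    complete : ∀ v → IsLinExt m n v → v ∈ exts
    count    : length exts ≡ e

-- The ring ℤ[√6697] (6697 = 37·181 is squarefree), as pairs re + im·√6697.

record Zd : Set where
  constructor _+√d·_
  field
    re im : ℤ

infixl 6 _⊕_
infixl 7 _⊗_

_⊕_ : Zd → Zd → Zd
(x +√d· y) ⊕ (u +√d· w) = (x ℤ.+ u) +√d· (y ℤ.+ w)

_⊖_ : Zd → Zd → Zd
(x +√d· y) ⊖ (u +√d· w) = (x ℤ.- u) +√d· (y ℤ.- w)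

_⊗_ : Zd → Zd → Zd
(x +√d· y) ⊗ (u +√d· w) =
  (x ℤ.* u ℤ.+ (+ 6697) ℤ.* y ℤ.* w) +√d· (x ℤ.* w ℤ.+ y ℤ.* u)

ι : ℕ → Zd
ι n = (+ n) +√d· (+ 0)

√d : Zd
√d = (+ 0) +√d· (+ 1)

_^^_ : Zd → ℕ → Zd
x ^^ zero  = ι 1
x ^^ suc k = x ⊗ (x ^^ k)

θ θ̄ : Zd
θ  = (+ 82) +√d· (+ 1)
θ̄ = (+ 82) +√d· (ℤ.- (+ 1))

D S : ℕ → Zd
D k = (θ ^^ k) ⊖ (θ̄ ^^ k)
S k = (θ ^^ k) ⊕ (θ̄ ^^ k)

module Submission where

-- The last element of a linear extension of P(m,n) is a maximal element: a_m unless
-- a_m ≼ b_n, and b_n unless b_n ≼ a_m.  So E(m,n) = E(m-1,n) + E(m,n-1), where a summand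
-- is dropped when the corresponding element is not maximal.  The order is explicit
-- (a_i ≼ b_j iff j ≥ bAbove i, b_j ≼ a_i iff i ≥ aAbove j), and the thresholds commute
-- with shifting indices by 5, so the recurrence is the same in every block of five rows.
-- Writing θ^k = θre k + θim k √6697, the claims E(c+5k, d+5k) = p θre k + q θim k for a
-- finite table of (c, d) are proved together by induction on k: row c+5 at k is row c at
-- k+1, and θ^(k+1) = θ θ^k turns (p, q) at k+1 into (82p + q, 6697p + 82q) at k.  Finally
-- D_k = 2 θim k √6697 and S_k = 2 θre k.

open import Defs
open import Data.Nat
  using (ℕ; zero; suc; _+_; _*_; _∸_; _≤_; _<_; z≤n; s≤s; s≤s⁻¹; _%_; _≤?_; _≟_; _≤′_; ≤′-refl; ≤′-step)
open import Data.Nat.Properties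
open import Data.Nat.DivMod using (m%n<n; %-distribˡ-+; [m+kn]%n≡m%n)
open import Data.Nat.Tactic.RingSolver using (solve-∀)
open import Data.Integer as ℤ using (+_)
import Data.Integer.Properties as ℤ
open import Data.Integer.Tactic.RingSolver renaming (solve-∀ to ℤ-solve-∀)
open import Data.Fin using (toℕ) renaming (zero to fzero; suc to fsuc)
open import Data.Product using (_×_; _,_; proj₁; ∃-syntax)
open import Data.Sum using (_⊎_; inj₁; inj₂)
open import Data.List using (List; []; _∷_; _++_; [_]; _∷ʳ_; map; length; applyUpTo; lookup; initLast; _∷ʳ′_)
open import Data.List.Properties using (applyUpTo-∷ʳ; ++-assoc; ∷ʳ-injectiveˡ; ∷ʳ-injectiveʳ; length-++; length-map)
open import Data.List.Relation.Unary.All as All using (All; []; _∷_)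
import Data.List.Relation.Unary.All.Properties as All
open import Data.List.Relation.Unary.Any as Any using (here)
open import Data.List.Relation.Unary.Any.Properties using (lookup-index)
open import Data.List.Relation.Unary.AllPairs using ([]; _∷_)
open import Data.List.Relation.Unary.Unique.Propositional using (Unique)
import Data.List.Relation.Unary.Unique.Propositional.Properties as Unique
open import Data.List.Membership.Propositional using (_∈_)
open import Data.List.Membership.Propositional.Properties
  using (∈-++⁻; ∈-++⁺ˡ; ∈-++⁺ʳ; ∈-map⁺; ∈-map⁻; ∈-applyUpTo⁺; ∈-applyUpTo⁻; ∈-lookup)
open import Data.List.Relation.Binary.Permutation.Propositional using (_↭_; ↭-refl; ↭-sym; ↭-trans; ↭-reflexive; prep)
open import Data.List.Relation.Binary.Permutation.Propositional.Properties
  using (∈-resp-↭; shift; drop-∷; ∷↭∷ʳ; ↭-empty-inv; ¬x∷xs↭[])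
open import Relation.Nullary using (¬_; Dec; yes; no; contradiction)
open import Relation.Nullary.Decidable using (True; False; toWitness; toWitnessFalse)
open import Relation.Binary.PropositionalEquality hiding ([_])
open import Relation.Binary.Construct.Closure.ReflexiveTransitive using (ε; _◅_; _◅◅_)

index : El → ℕ
index (a i) = i
index (b j) = j

Gen⇒index< : ∀ {x y} → Gen x y → index x < index y
Gen⇒index< (chainA _) = ≤-refl
Gen⇒index< (chainB _) = ≤-refl
Gen⇒index< (a≤b _ _) = ≤-refl
Gen⇒index< {b j} (b≤a _ _) = m<m+n j (s≤s z≤n)

≼⇒index≤ : ∀ {x y} → x ≼ y → index x ≤ index y
≼⇒index≤ ε = ≤-refl
≼⇒index≤ (g ◅ p) = ≤-trans (<⇒≤ (Gen⇒index< g)) (≼⇒index≤ p)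

a-chain′ : ∀ {i j} → 1 ≤ i → i ≤′ j → a i ≼ a j
a-chain′ 1≤i ≤′-refl = ε
a-chain′ 1≤i (≤′-step i≤j) = a-chain′ 1≤i i≤j ◅◅ chainA (≤-trans 1≤i (≤′⇒≤ i≤j)) ◅ ε

b-chain′ : ∀ {i j} → 1 ≤ i → i ≤′ j → b i ≼ b j
b-chain′ 1≤i ≤′-refl = ε
b-chain′ 1≤i (≤′-step i≤j) = b-chain′ 1≤i i≤j ◅◅ chainB (≤-trans 1≤i (≤′⇒≤ i≤j)) ◅ ε

a-chain : ∀ {i j} → 1 ≤ i → i ≤ j → a i ≼ a j
a-chain 1≤i i≤j = a-chain′ 1≤i (≤⇒≤′ i≤j)

b-chain : ∀ {i j} → 1 ≤ i → i ≤ j → b i ≼ b j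
b-chain 1≤i i≤j = b-chain′ 1≤i (≤⇒≤′ i≤j)

-- The gaps come from a_i < b_(i+1) for i ≢ 0, else a_i < a_(i+1) < b_(i+2); and from
-- b_j < a_(j+2) for j ≡ 0, 2, 4, else b_j < b_(j+1) < a_(j+3)  (residues mod 5).
bGap aGap : ℕ → ℕ
bGap 0 = 2
bGap _ = 1
aGap 1 = 3
aGap 3 = 3
aGap _ = 2

bAbove aAbove : ℕ → ℕ
bAbove i = bGap (i % 5) + i
aAbove j = aGap (j % 5) + j

1≤bGap : ∀ r → 1 ≤ bGap r
1≤bGap zero = s≤s z≤n
1≤bGap (suc _) = ≤-refl

bGap≤2 : ∀ r → bGap r ≤ 2
bGap≤2 zero = ≤-refl
bGap≤2 (suc _) = s≤s z≤n

2≤aGap : ∀ r → 2 ≤ aGap r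
2≤aGap 0 = ≤-refl
2≤aGap 1 = n≤1+n 2
2≤aGap 2 = ≤-refl
2≤aGap 3 = n≤1+n 2
2≤aGap (suc (suc (suc (suc _)))) = ≤-refl

aGap≤3 : ∀ r → aGap r ≤ 3
aGap≤3 0 = n≤1+n 2
aGap≤3 1 = ≤-refl
aGap≤3 2 = n≤1+n 2
aGap≤3 3 = ≤-refl
aGap≤3 (suc (suc (suc (suc _)))) = n≤1+n 2

i<bAbove : ∀ i → i < bAbove i
i<bAbove i = +-monoˡ-≤ i (1≤bGap (i % 5))

bAbove≤2+ : ∀ i → bAbove i ≤ 2 + i
bAbove≤2+ i = +-monoˡ-≤ i (bGap≤2 (i % 5))

2+≤aAbove : ∀ j → 2 + j ≤ aAbove j
2+≤aAbove j = +-monoˡ-≤ j (2≤aGap (j % 5))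

aAbove≤3+ : ∀ j → aAbove j ≤ 3 + j
aAbove≤3+ j = +-monoˡ-≤ j (aGap≤3 (j % 5))

bAbove-≢0 : ∀ {i} → i % 5 ≢ 0 → bAbove i ≡ suc i
bAbove-≢0 {i} i≢0 with i % 5
... | zero = contradiction refl i≢0
... | suc _ = refl

EvenResidue : ℕ → Set
EvenResidue j = j % 5 ≡ 0 ⊎ j % 5 ≡ 2 ⊎ j % 5 ≡ 4

aAbove-even : ∀ {j} → EvenResidue j → aAbove j ≡ j + 2
aAbove-even {j} (inj₁ e) rewrite e = +-comm 2 j
aAbove-even {j} (inj₂ (inj₁ e)) rewrite e = +-comm 2 j
aAbove-even {j} (inj₂ (inj₂ e)) rewrite e = +-comm 2 j

suc-%5 : ∀ i → suc i % 5 ≡ suc (i % 5) % 5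
suc-%5 i = %-distribˡ-+ 1 i 5

bAbove-mono : ∀ i → bAbove i ≤ bAbove (suc i)
bAbove-mono i = ≤-trans (bAbove≤2+ i) (i<bAbove (suc i))

aAbove-mono : ∀ j → aAbove j ≤ aAbove (suc j)
aAbove-mono j = ≤-trans (aAbove≤3+ j) (2+≤aAbove (suc j))

_⊑_ : El → El → Set
a i ⊑ a j = i ≤ j
b i ⊑ b j = i ≤ j
a i ⊑ b j = bAbove i ≤ j
b j ⊑ a i = aAbove j ≤ i

⊑-refl : ∀ x → x ⊑ x
⊑-refl (a i) = ≤-refl
⊑-refl (b j) = ≤-refl

Gen-⊑-trans : ∀ {x y} z → Gen x y → y ⊑ z → x ⊑ z
Gen-⊑-trans (a j) (chainA _) i<j = <⇒≤ i<j
Gen-⊑-trans (b j) (chainA {i} _) le = ≤-trans (bAbove-mono i) le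
Gen-⊑-trans (b i) (chainB _) j<i = <⇒≤ j<i
Gen-⊑-trans (a i) (chainB {j} _) le = ≤-trans (aAbove-mono j) le
Gen-⊑-trans (b j) (a≤b _ i≢0) le = subst (_≤ j) (sym (bAbove-≢0 i≢0)) le
Gen-⊑-trans (a j) (a≤b {i} _ _) le = ≤-trans (≤-trans (m≤n+m i 3) (2+≤aAbove (suc i))) le
Gen-⊑-trans (a i) (b≤a _ ev) le = subst (_≤ i) (sym (aAbove-even ev)) le
Gen-⊑-trans (b i) (b≤a {j} _ _) le = ≤-trans (m≤m+n j 2) (≤-trans (<⇒≤ (i<bAbove (j + 2))) le)

≼⇒⊑ : ∀ {x y} → x ≼ y → x ⊑ y
≼⇒⊑ {x} ε = ⊑-refl x
≼⇒⊑ {y = z} (g ◅ p) = Gen-⊑-trans z g (≼⇒⊑ p)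

a≼b-bAbove : ∀ {i} → 1 ≤ i → a i ≼ b (bAbove i)
a≼b-bAbove {i} 1≤i with i % 5 in eq
... | zero = chainA 1≤i ◅ a≤b (s≤s z≤n) suc-i≢0 ◅ ε
  where
  suc-i≢0 : suc i % 5 ≢ 0
  suc-i≢0 e = 1+n≢0 (trans (cong (λ r → suc r % 5) (sym eq)) (trans (sym (suc-%5 i)) e))
... | suc _ = a≤b 1≤i (λ e → 1+n≢0 (trans (sym eq) e)) ◅ ε

b≼a-direct : ∀ {j} → 1 ≤ j → EvenResidue j → b j ≼ a (2 + j)
b≼a-direct {j} 1≤j ev = subst (λ i → b j ≼ a i) (+-comm j 2) (b≤a 1≤j ev ◅ ε)

b≼a-aAbove : ∀ {j} → 1 ≤ j → b j ≼ a (aAbove j)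
b≼a-aAbove {j} 1≤j with j % 5 in eq | m%n<n j 5
... | 0 | _ = b≼a-direct 1≤j (inj₁ eq)
... | 1 | _ = chainB 1≤j ◅ b≼a-direct (s≤s z≤n) (inj₂ (inj₁ (trans (suc-%5 j) (cong (λ r → suc r % 5) eq))))
... | 2 | _ = b≼a-direct 1≤j (inj₂ (inj₁ eq))
... | 3 | _ = chainB 1≤j ◅ b≼a-direct (s≤s z≤n) (inj₂ (inj₂ (trans (suc-%5 j) (cong (λ r → suc r % 5) eq))))
... | 4 | _ = b≼a-direct 1≤j (inj₂ (inj₂ eq))
... | suc (suc (suc (suc (suc _)))) | s≤s (s≤s (s≤s (s≤s (s≤s ()))))

bAbove≤⇒a≼b : ∀ {i j} → 1 ≤ i → bAbove i ≤ j → a i ≼ b j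
bAbove≤⇒a≼b {i} 1≤i le = a≼b-bAbove 1≤i ◅◅ b-chain (≤-trans (s≤s z≤n) (i<bAbove i)) le

aAbove≤⇒b≼a : ∀ {j i} → 1 ≤ j → aAbove j ≤ i → b j ≼ a i
aAbove≤⇒b≼a {j} 1≤j le = b≼a-aAbove 1≤j ◅◅ a-chain (≤-trans (s≤s z≤n) (2+≤aAbove j)) le

_⋠_ : El → List El → Set
x ⋠ u = All (λ y → ¬ x ≼ y) u

data Compatible : List El → Set where
  [] : Compatible []
  _∷_ : ∀ {x xs} → All (λ y → ¬ y ≼ x) xs → Compatible xs → Compatible (x ∷ xs)

compatible-∷ʳ⁺ : ∀ {u x} → Compatible u → x ⋠ u → Compatible (u ∷ʳ x)
compatible-∷ʳ⁺ [] [] = [] ∷ []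
compatible-∷ʳ⁺ (h ∷ c) (t ∷ ts) = All.++⁺ h (t ∷ []) ∷ compatible-∷ʳ⁺ c ts

compatible-∷ʳ⁻ : ∀ u {x} → Compatible (u ∷ʳ x) → Compatible u × x ⋠ u
compatible-∷ʳ⁻ [] _ = [] , []
compatible-∷ʳ⁻ (y ∷ u) (h ∷ c) with compatible-∷ʳ⁻ u c | All.++⁻ u h
... | cu , top | hu , (t ∷ []) = hu ∷ cu , t ∷ top

compatible⇒respects : ∀ {v} → Compatible v → ∀ i j → lookup v i ≼ lookup v j → toℕ i ≤ toℕ j
compatible⇒respects (h ∷ c) fzero j _ = z≤n
compatible⇒respects (h ∷ c) (fsuc i) fzero le = contradiction le (All.lookup h (∈-lookup i))
compatible⇒respects (h ∷ c) (fsuc i) (fsuc j) le = s≤s (compatible⇒respects c i j le)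

respects⇒compatible : ∀ v → (∀ i j → lookup v i ≼ lookup v j → toℕ i ≤ toℕ j) → Compatible v
respects⇒compatible [] r = []
respects⇒compatible (x ∷ xs) r =
  All.tabulate below-x ∷ respects⇒compatible xs (λ i j le → s≤s⁻¹ (r (fsuc i) (fsuc j) le))
  where
  below-x : ∀ {y} → y ∈ xs → ¬ y ≼ x
  below-x y∈ y≼x = n≮0 (r (fsuc (Any.index y∈)) fzero (subst (_≼ x) (lookup-index y∈) y≼x))

elems-sucˡ : ∀ m n → elems (suc m) n ↭ a (suc m) ∷ elems m n
elems-sucˡ m n = ↭-trans (↭-reflexive split) (shift (a (suc m)) as bs)
  where
  as bs : List El
  as = applyUpTo (λ i → a (suc i)) m
  bs = applyUpTo (λ j → b (suc j)) n
  split : elems (suc m) n ≡ as ++ [ a (suc m) ] ++ bs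
  split = trans (cong (_++ bs) (sym (applyUpTo-∷ʳ _ m))) (++-assoc as _ bs)

elems-sucʳ : ∀ m n → elems m (suc n) ↭ b (suc n) ∷ elems m n
elems-sucʳ m n = ↭-trans (↭-reflexive split) (↭-sym (∷↭∷ʳ (b (suc n)) (elems m n)))
  where
  as bs : List El
  as = applyUpTo (λ i → a (suc i)) m
  bs = applyUpTo (λ j → b (suc j)) n
  split : elems m (suc n) ≡ elems m n ∷ʳ b (suc n)
  split = trans (cong (as ++_) (sym (applyUpTo-∷ʳ _ n))) (sym (++-assoc as bs _))

∈-elems⁻ : ∀ m n {y} → y ∈ elems m n →
           (∃[ i ] (i < m × y ≡ a (suc i))) ⊎ (∃[ j ] (j < n × y ≡ b (suc j)))
∈-elems⁻ m n y∈ with ∈-++⁻ (applyUpTo (λ i → a (suc i)) m) y∈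
... | inj₁ y∈as = inj₁ (∈-applyUpTo⁻ _ y∈as)
... | inj₂ y∈bs = inj₂ (∈-applyUpTo⁻ _ y∈bs)

a∈elems : ∀ {m i} n → i < m → a (suc i) ∈ elems m n
a∈elems n i<m = ∈-++⁺ˡ (∈-applyUpTo⁺ (λ i → a (suc i)) i<m)

b∈elems : ∀ m {n j} → j < n → b (suc j) ∈ elems m n
b∈elems m j<n = ∈-++⁺ʳ (applyUpTo (λ i → a (suc i)) m) (∈-applyUpTo⁺ (λ j → b (suc j)) j<n)

∷ʳ-↭⁺ : ∀ {A : Set} {u w : List A} x → u ↭ w → u ∷ʳ x ↭ x ∷ w
∷ʳ-↭⁺ {u = u} x p = ↭-trans (↭-sym (∷↭∷ʳ x u)) (prep x p)

∷ʳ-↭⁻ : ∀ {A : Set} {u w : List A} x → u ∷ʳ x ↭ x ∷ w → u ↭ w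
∷ʳ-↭⁻ {u = u} x p = drop-∷ (↭-trans (∷↭∷ʳ x u) p)

Extension : ℕ → ℕ → List El → Set
Extension m n v = v ↭ elems m n × Compatible v

a-maximal : ∀ {m n y} → ¬ bAbove (suc m) ≤ n → y ∈ elems m n → ¬ a (suc m) ≼ y
a-maximal {m} {n} a⋠b y∈ le with ∈-elems⁻ m n y∈
... | inj₁ (i , i<m , refl) = <⇒≱ i<m (s≤s⁻¹ (≼⇒index≤ le))
... | inj₂ (j , j<n , refl) = a⋠b (≤-trans (≼⇒⊑ le) j<n)

b-maximal : ∀ {m n y} → ¬ aAbove (suc n) ≤ m → y ∈ elems m n → ¬ b (suc n) ≼ y
b-maximal {m} {n} b⋠a y∈ le with ∈-elems⁻ m n y∈
... | inj₁ (i , i<m , refl) = b⋠a (≤-trans (≼⇒⊑ le) i<m)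
... | inj₂ (j , j<n , refl) = <⇒≱ j<n (s≤s⁻¹ (≼⇒index≤ le))

extend-a : ∀ {m n u} → ¬ bAbove (suc m) ≤ n → Extension m n u → Extension (suc m) n (u ∷ʳ a (suc m))
extend-a {m} {n} a⋠b (p , c) =
    ↭-trans (∷ʳ-↭⁺ _ p) (↭-sym (elems-sucˡ m n))
  , compatible-∷ʳ⁺ c (All.tabulate (λ y∈ → a-maximal a⋠b (∈-resp-↭ p y∈)))

extend-b : ∀ {m n u} → ¬ aAbove (suc n) ≤ m → Extension m n u → Extension m (suc n) (u ∷ʳ b (suc n))
extend-b {m} {n} b⋠a (p , c) =
    ↭-trans (∷ʳ-↭⁺ _ p) (↭-sym (elems-sucʳ m n))
  , compatible-∷ʳ⁺ c (All.tabulate (λ y∈ → b-maximal b⋠a (∈-resp-↭ p y∈)))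

bAbove≰0 : ∀ i → ¬ bAbove i ≤ 0
bAbove≰0 i le = n≮0 (≤-trans (i<bAbove i) le)

aAbove≰0 : ∀ j → ¬ aAbove j ≤ 0
aAbove≰0 j le = n≮0 (≤-trans (2+≤aAbove j) le)

unless : ∀ {P A : Set} → Dec P → List A → List A
unless (yes _) _ = []
unless (no _) xs = xs

unless-All : ∀ {P A : Set} {Q : A → Set} (d : Dec P) {xs} → (¬ P → All Q xs) → All Q (unless d xs)
unless-All (yes _) _ = []
unless-All (no ¬p) h = h ¬p

unless-unique : ∀ {P A : Set} (d : Dec P) {xs : List A} → Unique xs → Unique (unless d xs)
unless-unique (yes _) _ = []
unless-unique (no _) u = u

∈-unless⁺ : ∀ {P A : Set} (d : Dec P) {xs : List A} {v} → ¬ P → v ∈ xs → v ∈ unless d xs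
∈-unless⁺ (yes p) ¬p _ = contradiction p ¬p
∈-unless⁺ (no _) _ v∈ = v∈

∈-unless⁻ : ∀ {P A : Set} (d : Dec P) {xs : List A} {v} → v ∈ unless d xs → v ∈ xs
∈-unless⁻ (no _) v∈ = v∈

a≼b? : ∀ m n → Dec (bAbove (suc m) ≤ suc n)
a≼b? m n = bAbove (suc m) ≤? suc n

b≼a? : ∀ m n → Dec (aAbove (suc n) ≤ suc m)
b≼a? m n = aAbove (suc n) ≤? suc m

-- Grouped by the last element, which is a_m or b_n, whichever of them is maximal.
linExts : ℕ → ℕ → List (List El)
linExts zero zero = [ [] ]
linExts (suc m) zero = map (_∷ʳ a (suc m)) (linExts m zero)
linExts zero (suc n) = map (_∷ʳ b (suc n)) (linExts zero n)
linExts (suc m) (suc n) =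
  unless (a≼b? m n) (map (_∷ʳ a (suc m)) (linExts m (suc n)))
  ++ unless (b≼a? m n) (map (_∷ʳ b (suc n)) (linExts (suc m) n))

linExts-sound : ∀ m n → All (Extension m n) (linExts m n)
linExts-sound zero zero = (↭-refl , []) ∷ []
linExts-sound (suc m) zero = All.map⁺ (All.map (extend-a (bAbove≰0 (suc m))) (linExts-sound m zero))
linExts-sound zero (suc n) = All.map⁺ (All.map (extend-b (aAbove≰0 (suc n))) (linExts-sound zero n))
linExts-sound (suc m) (suc n) = All.++⁺
  (unless-All (a≼b? m n) (λ a⋠b → All.map⁺ (All.map (extend-a a⋠b) (linExts-sound m (suc n)))))
  (unless-All (b≼a? m n) (λ b⋠a → All.map⁺ (All.map (extend-b b⋠a) (linExts-sound (suc m) n))))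

linExts-unique : ∀ m n → Unique (linExts m n)
linExts-unique zero zero = [] ∷ []
linExts-unique (suc m) zero = Unique.map⁺ (∷ʳ-injectiveˡ _ _) (linExts-unique m zero)
linExts-unique zero (suc n) = Unique.map⁺ (∷ʳ-injectiveˡ _ _) (linExts-unique zero n)
linExts-unique (suc m) (suc n) = Unique.++⁺
  (unless-unique (a≼b? m n) (Unique.map⁺ (∷ʳ-injectiveˡ _ _) (linExts-unique m (suc n))))
  (unless-unique (b≼a? m n) (Unique.map⁺ (∷ʳ-injectiveˡ _ _) (linExts-unique (suc m) n)))
  disjoint
  where
  disjoint : ∀ {v} → ¬ (v ∈ unless (a≼b? m n) (map (_∷ʳ a (suc m)) (linExts m (suc n)))
                      × v ∈ unless (b≼a? m n) (map (_∷ʳ b (suc n)) (linExts (suc m) n)))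
  disjoint (v∈ˡ , v∈ʳ) with ∈-map⁻ _ (∈-unless⁻ (a≼b? m n) v∈ˡ) | ∈-map⁻ _ (∈-unless⁻ (b≼a? m n) v∈ʳ)
  ... | u , _ , refl | w , _ , eq with ∷ʳ-injectiveʳ u w eq
  ... | ()

∈-∷ʳ⁻ : ∀ {A : Set} (u : List A) {x y} → y ∈ u ∷ʳ x → y ∈ u ⊎ y ≡ x
∈-∷ʳ⁻ u y∈ with ∈-++⁻ u y∈
... | inj₁ y∈u = inj₁ y∈u
... | inj₂ (here y≡x) = inj₂ y≡x

last-a-index : ∀ {m n u i} → u ∷ʳ a (suc i) ↭ elems (suc m) n → i ≤ m → a (suc i) ⋠ u → i ≡ m
last-a-index {m} {n} {u} p i≤m top with m≤n⇒m<n∨m≡n i≤m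
... | inj₂ i≡m = i≡m
... | inj₁ i<m with ∈-∷ʳ⁻ u (∈-resp-↭ (↭-sym p) (a∈elems n (n<1+n m)))
...   | inj₁ am∈u = contradiction (a-chain (s≤s z≤n) (s≤s (<⇒≤ i<m))) (All.lookup top am∈u)
...   | inj₂ refl = contradiction i<m (<-irrefl refl)

last-b-index : ∀ {m n u j} → u ∷ʳ b (suc j) ↭ elems m (suc n) → j ≤ n → b (suc j) ⋠ u → j ≡ n
last-b-index {m} {n} {u} p j≤n top with m≤n⇒m<n∨m≡n j≤n
... | inj₂ j≡n = j≡n
... | inj₁ j<n with ∈-∷ʳ⁻ u (∈-resp-↭ (↭-sym p) (b∈elems m (n<1+n n)))
...   | inj₁ bn∈u = contradiction (b-chain (s≤s z≤n) (s≤s (<⇒≤ j<n))) (All.lookup top bn∈u)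
...   | inj₂ refl = contradiction j<n (<-irrefl refl)

data LastElement : ℕ → ℕ → List El → Set where
  lastA : ∀ {m n u} → Extension m n u → a (suc m) ⋠ u → LastElement (suc m) n (u ∷ʳ a (suc m))
  lastB : ∀ {m n u} → Extension m n u → b (suc n) ⋠ u → LastElement m (suc n) (u ∷ʳ b (suc n))

lastElement : ∀ m n {v} → Extension m n v → v ≢ [] → LastElement m n v
lastElement m n {v} (p , c) v≢[] with initLast v
... | [] = contradiction refl v≢[]
... | u ∷ʳ′ x with compatible-∷ʳ⁻ u c | ∈-elems⁻ m n (∈-resp-↭ p (∈-++⁺ʳ u (here refl)))
...   | cu , top | inj₁ (i , s≤s i≤m , refl) with refl ← last-a-index p i≤m top =
  lastA (∷ʳ-↭⁻ _ (↭-trans p (elems-sucˡ i n)) , cu) top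
...   | cu , top | inj₂ (j , s≤s j≤n , refl) with refl ← last-b-index p j≤n top =
  lastB (∷ʳ-↭⁻ _ (↭-trans p (elems-sucʳ m j)) , cu) top

↭-cons⇒≢[] : ∀ {A : Set} {x : A} {xs v} → v ↭ x ∷ xs → v ≢ []
↭-cons⇒≢[] p refl = ¬x∷xs↭[] (↭-sym p)

Complete : ℕ → ℕ → Set
Complete m n = ∀ {v} → Extension m n v → v ∈ linExts m n

complete-sucˡ : ∀ {m v} → LastElement (suc m) zero v → Complete m zero → v ∈ linExts (suc m) zero
complete-sucˡ (lastA ext _) ih = ∈-map⁺ _ (ih ext)

complete-sucʳ : ∀ {n v} → LastElement zero (suc n) v → Complete zero n → v ∈ linExts zero (suc n)
complete-sucʳ (lastB ext _) ih = ∈-map⁺ _ (ih ext)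

complete-suc : ∀ {m n v} → LastElement (suc m) (suc n) v → Complete m (suc n) → Complete (suc m) n →
               v ∈ linExts (suc m) (suc n)
complete-suc {m} {n} (lastA ext top) ihˡ _ = ∈-++⁺ˡ (∈-unless⁺ (a≼b? m n) a⋠b (∈-map⁺ _ (ihˡ ext)))
  where
  a⋠b : ¬ bAbove (suc m) ≤ suc n
  a⋠b le = All.lookup top (∈-resp-↭ (↭-sym (proj₁ ext)) (b∈elems m (n<1+n n))) (bAbove≤⇒a≼b (s≤s z≤n) le)
complete-suc {m} {n} (lastB ext top) _ ihʳ = ∈-++⁺ʳ _ (∈-unless⁺ (b≼a? m n) b⋠a (∈-map⁺ _ (ihʳ ext)))
  where
  b⋠a : ¬ aAbove (suc n) ≤ suc m
  b⋠a le = All.lookup top (∈-resp-↭ (↭-sym (proj₁ ext)) (a∈elems n (n<1+n m))) (aAbove≤⇒b≼a (s≤s z≤n) le)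

linExts-complete : ∀ m n → Complete m n
linExts-complete zero zero (p , _) rewrite ↭-empty-inv p = here refl
linExts-complete (suc m) zero ext =
  complete-sucˡ (lastElement _ _ ext (↭-cons⇒≢[] (proj₁ ext))) (linExts-complete m zero)
linExts-complete zero (suc n) ext =
  complete-sucʳ (lastElement _ _ ext (↭-cons⇒≢[] (proj₁ ext))) (linExts-complete zero n)
linExts-complete (suc m) (suc n) ext =
  complete-suc (lastElement _ _ ext (↭-cons⇒≢[] (proj₁ ext))) (linExts-complete m (suc n)) (linExts-complete (suc m) n)

-- Opaque so that unifying  E m n  with  E m′ n′  compares indices instead of unfolding.
opaque
  E : ℕ → ℕ → ℕ
  E m n = length (linExts m n)

  E≡length : ∀ m n → E m n ≡ length (linExts m n)
  E≡length m n = refl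

  numLinExt-E : ∀ m n → NumLinExt m n (E m n)
  numLinExt-E m n = record
    { exts = linExts m n
    ; sound = All.map (λ (p , c) → record { perm = p ; respects = compatible⇒respects c }) (linExts-sound m n)
    ; distinct = linExts-unique m n
    ; complete = λ v ext → linExts-complete m n (IsLinExt.perm ext , respects⇒compatible v (IsLinExt.respects ext))
    ; count = refl
    }

  E-unfold-ab : ∀ {m n} → ¬ bAbove (suc m) ≤ suc n → ¬ aAbove (suc n) ≤ suc m →
                E (suc m) (suc n) ≡ E m (suc n) + E (suc m) n
  E-unfold-ab {m} {n} a⋠b b⋠a with a≼b? m n | b≼a? m n
  ... | yes a≼b | _ = contradiction a≼b a⋠b
  ... | no _ | yes b≼a = contradiction b≼a b⋠a
  ... | no _ | no _ = trans (length-++ (map _ (linExts m (suc n))))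
                             (cong₂ _+_ (length-map (_∷ʳ a (suc m)) (linExts m (suc n)))
                                        (length-map (_∷ʳ b (suc n)) (linExts (suc m) n)))

  E-unfold-a : ∀ {m n} → ¬ bAbove (suc m) ≤ suc n → aAbove (suc n) ≤ suc m → E (suc m) (suc n) ≡ E m (suc n)
  E-unfold-a {m} {n} a⋠b b≼a with a≼b? m n | b≼a? m n
  ... | yes a≼b | _ = contradiction a≼b a⋠b
  ... | no _ | no b⋠a = contradiction b≼a b⋠a
  ... | no _ | yes _ = trans (length-++ (map _ (linExts m (suc n))))
                              (trans (+-identityʳ _) (length-map (_∷ʳ a (suc m)) (linExts m (suc n))))

  E-unfold-b : ∀ {m n} → bAbove (suc m) ≤ suc n → ¬ aAbove (suc n) ≤ suc m → E (suc m) (suc n) ≡ E (suc m) n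
  E-unfold-b {m} {n} a≼b b⋠a with a≼b? m n | b≼a? m n
  ... | no a⋠b | _ = contradiction a≼b a⋠b
  ... | yes _ | yes b≼a = contradiction b≼a b⋠a
  ... | yes _ | no _ = length-map (_∷ʳ b (suc n)) (linExts (suc m) n)

ShiftEquivariant : (ℕ → ℕ) → Set
ShiftEquivariant f = ∀ i k → f (i + 5 * k) ≡ f i + 5 * k

%5-periodic : ∀ i k → (i + 5 * k) % 5 ≡ i % 5
%5-periodic i k = trans (cong (λ t → (i + t) % 5) (*-comm 5 k)) ([m+kn]%n≡m%n i k 5)

bAbove-periodic : ShiftEquivariant bAbove
bAbove-periodic i k = trans (cong (λ r → bGap r + (i + 5 * k)) (%5-periodic i k)) (sym (+-assoc (bGap (i % 5)) i (5 * k)))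

aAbove-periodic : ShiftEquivariant aAbove
aAbove-periodic j k = trans (cong (λ r → aGap r + (j + 5 * k)) (%5-periodic j k)) (sym (+-assoc (aGap (j % 5)) j (5 * k)))

shift-≤ : ∀ f → ShiftEquivariant f → ∀ {i j} k → f i ≤ j → f (i + 5 * k) ≤ j + 5 * k
shift-≤ f eqv {i} {j} k le = subst (_≤ j + 5 * k) (sym (eqv i k)) (+-monoˡ-≤ (5 * k) le)

shift-≰ : ∀ f → ShiftEquivariant f → ∀ {i j} k → ¬ f i ≤ j → ¬ f (i + 5 * k) ≤ j + 5 * k
shift-≰ f eqv {i} {j} k ≰ le = ≰ (+-cancelʳ-≤ (5 * k) (f i) j (subst (_≤ j + 5 * k) (eqv i k) le))

θre θim : ℕ → ℕ
θre zero = 1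
θre (suc k) = 82 * θre k + 6697 * θim k
θim zero = 0
θim (suc k) = θre k + 82 * θim k

-- Opaque, so that  lin p q k ≡ lin 23 1883 k  determines p and q.
opaque
  lin : ℕ → ℕ → ℕ → ℕ
  lin p q k = p * θre k + q * θim k

  lin-unfold : ∀ p q k → lin p q k ≡ p * θre k + q * θim k
  lin-unfold p q k = refl

  lin-zero : ∀ p q → lin p q 0 ≡ p
  lin-zero p q = identity p q
    where
    identity : ∀ p q → p * 1 + q * 0 ≡ p
    identity = solve-∀

  lin-suc : ∀ p q k → lin p q (suc k) ≡ lin (82 * p + q) (6697 * p + 82 * q) k
  lin-suc p q k = identity p q (θre k) (θim k)
    where
    identity : ∀ p q x y → p * (82 * x + 6697 * y) + q * (x + 82 * y) ≡ (82 * p + q) * x + (6697 * p + 82 * q) * y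
    identity = solve-∀

  lin-+ : ∀ {p q p′ q′} k → lin p q k + lin p′ q′ k ≡ lin (p + p′) (q + q′) k
  lin-+ {p} {q} {p′} {q′} k = identity p q p′ q′ (θre k) (θim k)
    where
    identity : ∀ p q p′ q′ x y → (p * x + q * y) + (p′ * x + q′ * y) ≡ (p + p′) * x + (q + q′) * y
    identity = solve-∀

  *-lin : ∀ r p q k → r * lin p q k ≡ lin (r * p) (r * q) k
  *-lin r p q k = identity r p q (θre k) (θim k)
    where
    identity : ∀ r p q x y → r * (p * x + q * y) ≡ (r * p) * x + (r * q) * y
    identity = solve-∀

E-base : ∀ {m n p q} → length (linExts m n) ≡ p → E m n ≡ lin p q 0
E-base {m} {n} {p} {q} h = trans (trans (E≡length m n) h) (sym (lin-zero p q))

E-shift : ∀ c d k {p q} → E (5 + c + 5 * k) (5 + d + 5 * k) ≡ lin (82 * p + q) (6697 * p + 82 * q) k →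
          E (c + 5 * suc k) (d + 5 * suc k) ≡ lin p q (suc k)
E-shift c d k {p} {q} h = trans (cong₂ E (identity c k) (identity d k)) (trans h (sym (lin-suc p q k)))
  where
  identity : ∀ c k → c + 5 * (1 + k) ≡ 5 + c + 5 * k
  identity = solve-∀

E-scale : ∀ r {m n p q k} → E m n ≡ lin p q k → r * E m n ≡ lin (r * p) (r * q) k
E-scale r {p = p} {q} {k} h = trans (cong (r *_) h) (*-lin r p q k)

-- The coefficient sums are side conditions rather than part of the result type, where
-- Agda would meet constraints like  ?p + ?p′ = 2290  before checking the arguments.
E-step-ab : ∀ c d k {p q p′ q′ r s}
            {a⋠b : False (bAbove (suc c) ≤? suc d)} {b⋠a : False (aAbove (suc d) ≤? suc c)}
            {p+p′≡r : True (p + p′ ≟ r)} {q+q′≡s : True (q + q′ ≟ s)} →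
            E (c + 5 * k) (suc d + 5 * k) ≡ lin p q k → E (suc c + 5 * k) (d + 5 * k) ≡ lin p′ q′ k →
            E (suc c + 5 * k) (suc d + 5 * k) ≡ lin r s k
E-step-ab c d k {p} {q} {p′} {q′} {r} {s} {a⋠b} {b⋠a} {p+p′≡r} {q+q′≡s} h h′ = begin
  E (suc c + 5 * k) (suc d + 5 * k)                             ≡⟨ E-unfold-ab a⋠b′ b⋠a′ ⟩
  E (c + 5 * k) (suc d + 5 * k) + E (suc c + 5 * k) (d + 5 * k) ≡⟨ cong₂ _+_ h h′ ⟩
  lin p q k + lin p′ q′ k                                       ≡⟨ lin-+ k ⟩
  lin (p + p′) (q + q′) k                                       ≡⟨ cong₂ (λ x y → lin x y k) (toWitness p+p′≡r) (toWitness q+q′≡s) ⟩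
  lin r s k                                                     ∎
  where
  open ≡-Reasoning
  a⋠b′ : ¬ bAbove (suc c + 5 * k) ≤ suc d + 5 * k
  a⋠b′ = shift-≰ bAbove bAbove-periodic {suc c} {suc d} k (toWitnessFalse a⋠b)
  b⋠a′ : ¬ aAbove (suc d + 5 * k) ≤ suc c + 5 * k
  b⋠a′ = shift-≰ aAbove aAbove-periodic {suc d} {suc c} k (toWitnessFalse b⋠a)

E-step-a : ∀ c d k {p q}
           {a⋠b : False (bAbove (suc c) ≤? suc d)} {b≼a : True (aAbove (suc d) ≤? suc c)} →
           E (c + 5 * k) (suc d + 5 * k) ≡ lin p q k → E (suc c + 5 * k) (suc d + 5 * k) ≡ lin p q k
E-step-a c d k {a⋠b = a⋠b} {b≼a} = trans (E-unfold-a a⋠b′ b≼a′)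
  where
  a⋠b′ : ¬ bAbove (suc c + 5 * k) ≤ suc d + 5 * k
  a⋠b′ = shift-≰ bAbove bAbove-periodic {suc c} {suc d} k (toWitnessFalse a⋠b)
  b≼a′ : aAbove (suc d + 5 * k) ≤ suc c + 5 * k
  b≼a′ = shift-≤ aAbove aAbove-periodic {suc d} {suc c} k (toWitness b≼a)

E-step-b : ∀ c d k {p q}
           {a≼b : True (bAbove (suc c) ≤? suc d)} {b⋠a : False (aAbove (suc d) ≤? suc c)} →
           E (suc c + 5 * k) (d + 5 * k) ≡ lin p q k → E (suc c + 5 * k) (suc d + 5 * k) ≡ lin p q k
E-step-b c d k {a≼b = a≼b} {b⋠a} = trans (E-unfold-b a≼b′ b⋠a′)
  where
  a≼b′ : bAbove (suc c + 5 * k) ≤ suc d + 5 * k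
  a≼b′ = shift-≤ bAbove bAbove-periodic {suc c} {suc d} k (toWitness a≼b)
  b⋠a′ : ¬ aAbove (suc d + 5 * k) ≤ suc c + 5 * k
  b⋠a′ = shift-≰ aAbove aAbove-periodic {suc d} {suc c} k (toWitnessFalse b⋠a)

E₃₁ : ∀ k → E (3 + 5 * k) (1 + 5 * k) ≡ lin 4 340 k
E₃₂ : ∀ k → E (3 + 5 * k) (2 + 5 * k) ≡ lin 9 741 k
E₃₃ : ∀ k → E (3 + 5 * k) (3 + 5 * k) ≡ lin 14 1142 k
E₃₄ : ∀ k → E (3 + 5 * k) (4 + 5 * k) ≡ lin 14 1142 k
E₂₁ : ∀ k → E (2 + 5 * k) (1 + 5 * k) ≡ lin 3 247 k
E₂₂ : ∀ k → E (2 + 5 * k) (2 + 5 * k) ≡ lin 5 401 k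
E₁₀ : ∀ k → E (1 + 5 * k) (0 + 5 * k) ≡ lin 1 93 k
E₁₁ : ∀ k → E (1 + 5 * k) (1 + 5 * k) ≡ lin 2 154 k
E₀₁ : ∀ k → E (0 + 5 * k) (1 + 5 * k) ≡ lin 1 61 k
E₄₂ : ∀ k → E (4 + 5 * k) (2 + 5 * k) ≡ lin 9 741 k
E₄₃ : ∀ k → E (4 + 5 * k) (3 + 5 * k) ≡ lin 23 1883 k
E₄₄ : ∀ k → E (4 + 5 * k) (4 + 5 * k) ≡ lin 37 3025 k
E₄₅ : ∀ k → E (4 + 5 * k) (5 + 5 * k) ≡ lin 37 3025 k
E₄₆ : ∀ k → E (4 + 5 * k) (6 + 5 * k) ≡ lin 37 3025 k
E₅₂ : ∀ k → E (5 + 5 * k) (2 + 5 * k) ≡ lin 9 741 k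
E₅₃ : ∀ k → E (5 + 5 * k) (3 + 5 * k) ≡ lin 32 2624 k
E₅₄ : ∀ k → E (5 + 5 * k) (4 + 5 * k) ≡ lin 69 5649 k
E₅₅ : ∀ k → E (5 + 5 * k) (5 + 5 * k) ≡ lin 106 8674 k
E₅₆ : ∀ k → E (5 + 5 * k) (6 + 5 * k) ≡ lin 143 11699 k
E₆₄ : ∀ k → E (6 + 5 * k) (4 + 5 * k) ≡ lin 69 5649 k
E₆₅ : ∀ k → E (6 + 5 * k) (5 + 5 * k) ≡ lin 175 14323 k
E₆₆ : ∀ k → E (6 + 5 * k) (6 + 5 * k) ≡ lin 318 26022 k
E₆₇ : ∀ k → E (6 + 5 * k) (7 + 5 * k) ≡ lin 318 26022 k
E₇₅ : ∀ k → E (7 + 5 * k) (5 + 5 * k) ≡ lin 175 14323 k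
E₇₆ : ∀ k → E (7 + 5 * k) (6 + 5 * k) ≡ lin 493 40345 k
E₇₇ : ∀ k → E (7 + 5 * k) (7 + 5 * k) ≡ lin 811 66367 k
E₇₈ : ∀ k → E (7 + 5 * k) (8 + 5 * k) ≡ lin 811 66367 k
E₈₅ : ∀ k → E (8 + 5 * k) (5 + 5 * k) ≡ lin 175 14323 k
E₈₆ : ∀ k → E (8 + 5 * k) (6 + 5 * k) ≡ lin 668 54668 k
E₈₇ : ∀ k → E (8 + 5 * k) (7 + 5 * k) ≡ lin 1479 121035 k
E₈₈ : ∀ k → E (8 + 5 * k) (8 + 5 * k) ≡ lin 2290 187402 k
E₈₉ : ∀ k → E (8 + 5 * k) (9 + 5 * k) ≡ lin 2290 187402 k

E₃₁ zero = E-base refl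
E₃₁ (suc k) = E-shift 3 1 k (E₈₆ k)
E₃₂ zero = E-base refl
E₃₂ (suc k) = E-shift 3 2 k (E₈₇ k)
E₃₃ zero = E-base refl
E₃₃ (suc k) = E-shift 3 3 k (E₈₈ k)
E₃₄ zero = E-base refl
E₃₄ (suc k) = E-shift 3 4 k (E₈₉ k)
E₂₁ zero = E-base refl
E₂₁ (suc k) = E-shift 2 1 k (E₇₆ k)
E₂₂ zero = E-base refl
E₂₂ (suc k) = E-shift 2 2 k (E₇₇ k)
E₁₀ zero = E-base refl
E₁₀ (suc k) = E-shift 1 0 k (E₆₅ k)
E₁₁ zero = E-base refl
E₁₁ (suc k) = E-shift 1 1 k (E₆₆ k)
E₀₁ zero = E-base refl
E₀₁ (suc k) = E-shift 0 1 k (E₅₆ k)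
E₄₂ k = E-step-a 3 1 k (E₃₂ k)
E₄₃ k = E-step-ab 3 2 k (E₃₃ k) (E₄₂ k)
E₄₄ k = E-step-ab 3 3 k (E₃₄ k) (E₄₃ k)
E₄₅ k = E-step-b 3 4 k (E₄₄ k)
E₄₆ k = E-step-b 3 5 k (E₄₅ k)
E₅₂ k = E-step-a 4 1 k (E₄₂ k)
E₅₃ k = E-step-ab 4 2 k (E₄₃ k) (E₅₂ k)
E₅₄ k = E-step-ab 4 3 k (E₄₄ k) (E₅₃ k)
E₅₅ k = E-step-ab 4 4 k (E₄₅ k) (E₅₄ k)
E₅₆ k = E-step-ab 4 5 k (E₄₆ k) (E₅₅ k)
E₆₄ k = E-step-a 5 3 k (E₅₄ k)
E₆₅ k = E-step-ab 5 4 k (E₅₅ k) (E₆₄ k)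
E₆₆ k = E-step-ab 5 5 k (E₅₆ k) (E₆₅ k)
E₆₇ k = E-step-b 5 6 k (E₆₆ k)
E₇₅ k = E-step-a 6 4 k (E₆₅ k)
E₇₆ k = E-step-ab 6 5 k (E₆₆ k) (E₇₅ k)
E₇₇ k = E-step-ab 6 6 k (E₆₇ k) (E₇₆ k)
E₇₈ k = E-step-b 6 7 k (E₇₇ k)
E₈₅ k = E-step-a 7 4 k (E₇₅ k)
E₈₆ k = E-step-ab 7 5 k (E₇₆ k) (E₈₅ k)
E₈₇ k = E-step-ab 7 6 k (E₇₇ k) (E₈₆ k)
E₈₈ k = E-step-ab 7 7 k (E₇₈ k) (E₈₇ k)
E₈₉ k = E-step-b 7 8 k (E₈₈ k)

conj : Zd → Zd
conj (x +√d· y) = x +√d· (ℤ.- y)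

conj-⊗ : ∀ u v → conj (u ⊗ v) ≡ conj u ⊗ conj v
conj-⊗ (x +√d· y) (u +√d· w) = cong₂ _+√d·_ (re x y u w) (im x y u w)
  where
  re : ∀ x y u w → x ℤ.* u ℤ.+ + 6697 ℤ.* y ℤ.* w ≡ x ℤ.* u ℤ.+ + 6697 ℤ.* (ℤ.- y) ℤ.* (ℤ.- w)
  re = ℤ-solve-∀
  im : ∀ x y u w → ℤ.- (x ℤ.* w ℤ.+ y ℤ.* u) ≡ x ℤ.* (ℤ.- w) ℤ.+ (ℤ.- y) ℤ.* u
  im = ℤ-solve-∀

conj-^^ : ∀ u k → conj (u ^^ k) ≡ conj u ^^ k
conj-^^ u zero = refl
conj-^^ u (suc k) = trans (conj-⊗ u (u ^^ k)) (cong (conj u ⊗_) (conj-^^ u k))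

θ-step : ∀ x y → θ ⊗ ((+ x) +√d· (+ y)) ≡ (+ (82 * x + 6697 * y)) +√d· (+ (x + 82 * y))
θ-step x y = cong₂ _+√d·_
  (sym (cong₂ ℤ._+_ (ℤ.pos-* 82 x) (ℤ.pos-* 6697 y)))
  (trans (ℤ.+-comm (+ 82 ℤ.* + y) _) (cong₂ ℤ._+_ (ℤ.*-identityˡ (+ x)) (sym (ℤ.pos-* 82 y))))

θ-pow : ∀ k → θ ^^ k ≡ (+ θre k) +√d· (+ θim k)
θ-pow zero = refl
θ-pow (suc k) = trans (cong (θ ⊗_) (θ-pow k)) (θ-step (θre k) (θim k))

pureIm : ℕ → Zd
pureIm y = (+ 0) +√d· (+ y)

D-pureIm : ∀ k → D k ≡ pureIm (2 * θim k)
D-pureIm k = begin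
  (θ ^^ k) ⊖ (θ̄ ^^ k)                                           ≡⟨ cong ((θ ^^ k) ⊖_) (sym (conj-^^ θ k)) ⟩
  (θ ^^ k) ⊖ conj (θ ^^ k)                                      ≡⟨ cong (λ z → z ⊖ conj z) (θ-pow k) ⟩
  ((+ θre k) +√d· (+ θim k)) ⊖ ((+ θre k) +√d· (ℤ.- (+ θim k))) ≡⟨ cong₂ _+√d·_ (re (+ θre k)) (im (θim k)) ⟩
  pureIm (2 * θim k)                                            ∎
  where
  open ≡-Reasoning
  re : ∀ x → x ℤ.- x ≡ + 0
  re = ℤ-solve-∀
  im : ∀ y → + y ℤ.- ℤ.- (+ y) ≡ + (2 * y)
  im y = trans (twice (+ y)) (sym (ℤ.pos-* 2 y))
    where
    twice : ∀ y → y ℤ.- ℤ.- y ≡ + 2 ℤ.* y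
    twice = ℤ-solve-∀

S-ι : ∀ k → S k ≡ ι (2 * θre k)
S-ι k = begin
  (θ ^^ k) ⊕ (θ̄ ^^ k)                                           ≡⟨ cong ((θ ^^ k) ⊕_) (sym (conj-^^ θ k)) ⟩
  (θ ^^ k) ⊕ conj (θ ^^ k)                                      ≡⟨ cong (λ z → z ⊕ conj z) (θ-pow k) ⟩
  ((+ θre k) +√d· (+ θim k)) ⊕ ((+ θre k) +√d· (ℤ.- (+ θim k))) ≡⟨ cong₂ _+√d·_ (re (θre k)) (im (+ θim k)) ⟩
  ι (2 * θre k)                                                 ∎
  where
  open ≡-Reasoning
  re : ∀ x → + x ℤ.+ + x ≡ + (2 * x)
  re x = cong +_ (cong (λ t → x + t) (sym (+-identityʳ x)))
  im : ∀ y → y ℤ.- y ≡ + 0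
  im = ℤ-solve-∀

√d-scale : ∀ q e → ι q ⊗ √d ⊗ ι e ≡ pureIm (q * e)
√d-scale q e = cong₂ _+√d·_ (re (+ q) (+ e)) (trans (im (+ q) (+ e)) (sym (ℤ.pos-* q e)))
  where
  re : ∀ q e → (q ℤ.* + 0 ℤ.+ + 6697 ℤ.* + 0 ℤ.* + 1) ℤ.* e ℤ.+ + 6697 ℤ.* (q ℤ.* + 1 ℤ.+ + 0 ℤ.* + 0) ℤ.* + 0 ≡ + 0
  re = ℤ-solve-∀
  im : ∀ q e → (q ℤ.* + 0 ℤ.+ + 6697 ℤ.* + 0 ℤ.* + 1) ℤ.* + 0 ℤ.+ (q ℤ.* + 1 ℤ.+ + 0 ℤ.* + 0) ℤ.* e ≡ q ℤ.* e
  im = ℤ-solve-∀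

ι-⊗-pureIm : ∀ p y → ι p ⊗ pureIm y ≡ pureIm (p * y)
ι-⊗-pureIm p y = cong₂ _+√d·_ (re (+ p) (+ y)) (trans (im (+ p) (+ y)) (sym (ℤ.pos-* p y)))
  where
  re : ∀ p y → p ℤ.* + 0 ℤ.+ + 6697 ℤ.* + 0 ℤ.* y ≡ + 0
  re = ℤ-solve-∀
  im : ∀ p y → p ℤ.* y ℤ.+ + 0 ℤ.* + 0 ≡ p ℤ.* y
  im = ℤ-solve-∀

pD+r√dS : ∀ p r k → ι p ⊗ D k ⊕ ι r ⊗ √d ⊗ S k ≡ pureIm (lin (2 * r) (2 * p) k)
pD+r√dS p r k = begin
  ι p ⊗ D k ⊕ ι r ⊗ √d ⊗ S k                          ≡⟨ cong₂ (λ u v → ι p ⊗ u ⊕ ι r ⊗ √d ⊗ v) (D-pureIm k) (S-ι k) ⟩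
  ι p ⊗ pureIm (2 * θim k) ⊕ ι r ⊗ √d ⊗ ι (2 * θre k) ≡⟨ cong₂ _⊕_ (ι-⊗-pureIm p (2 * θim k)) (√d-scale r (2 * θre k)) ⟩
  pureIm (p * (2 * θim k) + r * (2 * θre k))          ≡⟨ cong pureIm (identity p r (θre k) (θim k)) ⟩
  pureIm (2 * r * θre k + 2 * p * θim k)              ≡⟨ cong pureIm (sym (lin-unfold (2 * r) (2 * p) k)) ⟩
  pureIm (lin (2 * r) (2 * p) k)                      ∎
  where
  open ≡-Reasoning
  identity : ∀ p r x y → p * (2 * y) + r * (2 * x) ≡ 2 * r * x + 2 * p * y
  identity = solve-∀

pD : ∀ p k → ι p ⊗ D k ≡ pureIm (lin 0 (2 * p) k)
pD p k = begin
  ι p ⊗ D k                          ≡⟨ cong (ι p ⊗_) (D-pureIm k) ⟩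
  ι p ⊗ pureIm (2 * θim k)           ≡⟨ ι-⊗-pureIm p (2 * θim k) ⟩
  pureIm (p * (2 * θim k))           ≡⟨ cong pureIm (identity p (θre k) (θim k)) ⟩
  pureIm (0 * θre k + 2 * p * θim k) ≡⟨ cong pureIm (sym (lin-unfold 0 (2 * p) k)) ⟩
  pureIm (lin 0 (2 * p) k)           ∎
  where
  open ≡-Reasoning
  identity : ∀ p x y → p * (2 * y) ≡ 0 * x + 2 * p * y
  identity = solve-∀

closedForm : ∀ q p r k {m n} → q * E m n ≡ lin (2 * r) (2 * p) k →
             ∃[ e ] (NumLinExt m n e × ι q ⊗ √d ⊗ ι e ≡ ι p ⊗ D k ⊕ ι r ⊗ √d ⊗ S k)
closedForm q p r k {m} {n} h =
  E m n , numLinExt-E m n , trans (√d-scale q (E m n)) (trans (cong pureIm h) (sym (pD+r√dS p r k)))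

closedForm-D : ∀ q p k {m n} → q * E m n ≡ lin 0 (2 * p) k →
               ∃[ e ] (NumLinExt m n e × ι q ⊗ √d ⊗ ι e ≡ ι p ⊗ D k)
closedForm-D q p k {m} {n} h =
  E m n , numLinExt-E m n , trans (√d-scale q (E m n)) (trans (cong pureIm h) (sym (pD p k)))

E-comm : ∀ c d k → E (5 * k + c) (5 * k + d) ≡ E (c + 5 * k) (d + 5 * k)
E-comm c d k = cong₂ E (+-comm (5 * k) c) (+-comm (5 * k) d)

E[5k+4,5k+4] : ∀ k → E (5 * k + 4) (5 * k + 4) ≡ lin 37 3025 k
E[5k+4,5k+4] k = trans (E-comm 4 4 k) (E₄₄ k)

E[5k+4,5k+3] : ∀ k → E (5 * k + 4) (5 * k + 3) ≡ lin 23 1883 k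
E[5k+4,5k+3] k = trans (E-comm 4 3 k) (E₄₃ k)

E[5k+3,5k+3] : ∀ k → E (5 * k + 3) (5 * k + 3) ≡ lin 14 1142 k
E[5k+3,5k+3] k = trans (E-comm 3 3 k) (E₃₃ k)

E[5k+3,5k+2] : ∀ k → E (5 * k + 3) (5 * k + 2) ≡ lin 9 741 k
E[5k+3,5k+2] k = trans (E-comm 3 2 k) (E₃₂ k)

E[5k+3,5k+1] : ∀ k → E (5 * k + 3) (5 * k + 1) ≡ lin 4 340 k
E[5k+3,5k+1] k = trans (E-comm 3 1 k) (E₃₁ k)

E[5k+2,5k+2] : ∀ k → E (5 * k + 2) (5 * k + 2) ≡ lin 5 401 k
E[5k+2,5k+2] k = trans (E-comm 2 2 k) (E₂₂ k)

E[5k+2,5k+1] : ∀ k → E (5 * k + 2) (5 * k + 1) ≡ lin 3 247 k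
E[5k+2,5k+1] k = trans (E-comm 2 1 k) (E₂₁ k)

E[5k+1,5k+1] : ∀ k → E (5 * k + 1) (5 * k + 1) ≡ lin 2 154 k
E[5k+1,5k+1] k = trans (E-comm 1 1 k) (E₁₁ k)

E[5k+1,5k] : ∀ k → E (5 * k + 1) (5 * k) ≡ lin 1 93 k
E[5k+1,5k] k = trans (cong₂ E (+-comm (5 * k) 1) refl) (E₁₀ k)

E[5k,5k+1] : ∀ k → E (5 * k) (5 * k + 1) ≡ lin 1 61 k
E[5k,5k+1] k = trans (cong₂ E refl (+-comm (5 * k) 1)) (E₀₁ k)

3*E[5k,5k] : ∀ k → 3 * E (5 * suc k) (5 * suc k) ≡ lin 2 154 (suc k)
3*E[5k,5k] k = begin
  3 * E (5 * suc k) (5 * suc k) ≡⟨ cong (λ i → 3 * E i i) (*-suc 5 k) ⟩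
  3 * E (5 + 5 * k) (5 + 5 * k) ≡⟨ E-scale 3 (E₅₅ k) ⟩
  lin 318 26022 k               ≡⟨ lin-suc 2 154 k ⟨
  lin 2 154 (suc k)             ∎
  where open ≡-Reasoning

6*E[5k,5k-1] : ∀ k → 6 * E (5 * suc k) (5 * suc k ∸ 1) ≡ lin 2 250 (suc k)
6*E[5k,5k-1] k = begin
  6 * E (5 * suc k) (5 * suc k ∸ 1) ≡⟨ cong (λ i → 6 * E i (i ∸ 1)) (*-suc 5 k) ⟩
  6 * E (5 + 5 * k) (4 + 5 * k)     ≡⟨ E-scale 6 (E₅₄ k) ⟩
  lin 414 33894 k                   ≡⟨ lin-suc 2 250 k ⟨
  lin 2 250 (suc k)                 ∎
  where open ≡-Reasoning

E[5k,5k-2] : ∀ k → E (5 * suc k) (5 * suc k ∸ 2) ≡ lin 0 32 (suc k)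
E[5k,5k-2] k = begin
  E (5 * suc k) (5 * suc k ∸ 2) ≡⟨ cong (λ i → E i (i ∸ 2)) (*-suc 5 k) ⟩
  E (5 + 5 * k) (3 + 5 * k)     ≡⟨ E₅₃ k ⟩
  lin 32 2624 k                 ≡⟨ lin-suc 0 32 k ⟨
  lin 0 32 (suc k)              ∎
  where open ≡-Reasoning

mainTheorem4 :
  (∀ (k : ℕ) →
      (∃[ e ] (NumLinExt (5 * k + 4) (5 * k + 4) e × ι 2 ⊗ √d ⊗ ι e ≡ ι 3025 ⊗ D k ⊕ ι 37 ⊗ √d ⊗ S k))
    × (∃[ e ] (NumLinExt (5 * k + 4) (5 * k + 3) e × ι 2 ⊗ √d ⊗ ι e ≡ ι 1883 ⊗ D k ⊕ ι 23 ⊗ √d ⊗ S k))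
    × (∃[ e ] (NumLinExt (5 * k + 3) (5 * k + 3) e × ι 1 ⊗ √d ⊗ ι e ≡ ι 571 ⊗ D k ⊕ ι 7 ⊗ √d ⊗ S k))
    × (∃[ e ] (NumLinExt (5 * k + 3) (5 * k + 2) e × ι 2 ⊗ √d ⊗ ι e ≡ ι 741 ⊗ D k ⊕ ι 9 ⊗ √d ⊗ S k))
    × (∃[ e ] (NumLinExt (5 * k + 3) (5 * k + 1) e × ι 1 ⊗ √d ⊗ ι e ≡ ι 170 ⊗ D k ⊕ ι 2 ⊗ √d ⊗ S k))
    × (∃[ e ] (NumLinExt (5 * k + 2) (5 * k + 2) e × ι 2 ⊗ √d ⊗ ι e ≡ ι 401 ⊗ D k ⊕ ι 5 ⊗ √d ⊗ S k))
    × (∃[ e ] (NumLinExt (5 * k + 2) (5 * k + 1) e × ι 2 ⊗ √d ⊗ ι e ≡ ι 247 ⊗ D k ⊕ ι 3 ⊗ √d ⊗ S k))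
    × (∃[ e ] (NumLinExt (5 * k + 1) (5 * k + 1) e × ι 1 ⊗ √d ⊗ ι e ≡ ι 77 ⊗ D k ⊕ ι 1 ⊗ √d ⊗ S k))
    × (∃[ e ] (NumLinExt (5 * k + 1) (5 * k) e × ι 2 ⊗ √d ⊗ ι e ≡ ι 93 ⊗ D k ⊕ ι 1 ⊗ √d ⊗ S k))
    × (∃[ e ] (NumLinExt (5 * k) (5 * k + 1) e × ι 2 ⊗ √d ⊗ ι e ≡ ι 61 ⊗ D k ⊕ ι 1 ⊗ √d ⊗ S k)))
  ×
  (∀ (k : ℕ) → 1 ≤ k →
      (∃[ e ] (NumLinExt (5 * k) (5 * k) e × ι 3 ⊗ √d ⊗ ι e ≡ ι 77 ⊗ D k ⊕ ι 1 ⊗ √d ⊗ S k))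
    × (∃[ e ] (NumLinExt (5 * k) (5 * k ∸ 1) e × ι 6 ⊗ √d ⊗ ι e ≡ ι 125 ⊗ D k ⊕ ι 1 ⊗ √d ⊗ S k))
    × (∃[ e ] (NumLinExt (5 * k) (5 * k ∸ 2) e × ι 1 ⊗ √d ⊗ ι e ≡ ι 16 ⊗ D k)))
mainTheorem4 =
  (λ k → closedForm 2 3025 37 k (E-scale 2 (E[5k+4,5k+4] k))
       , closedForm 2 1883 23 k (E-scale 2 (E[5k+4,5k+3] k))
       , closedForm 1 571 7 k (E-scale 1 (E[5k+3,5k+3] k))
       , closedForm 2 741 9 k (E-scale 2 (E[5k+3,5k+2] k))
       , closedForm 1 170 2 k (E-scale 1 (E[5k+3,5k+1] k))
       , closedForm 2 401 5 k (E-scale 2 (E[5k+2,5k+2] k))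
       , closedForm 2 247 3 k (E-scale 2 (E[5k+2,5k+1] k))
       , closedForm 1 77 1 k (E-scale 1 (E[5k+1,5k+1] k))
       , closedForm 2 93 1 k (E-scale 2 (E[5k+1,5k] k))
       , closedForm 2 61 1 k (E-scale 2 (E[5k,5k+1] k)))
  , λ { zero ()
      ; (suc k) _ → closedForm 3 77 1 (suc k) (3*E[5k,5k] k)
                  , closedForm 6 125 1 (suc k) (6*E[5k,5k-1] k)
                  , closedForm-D 1 16 (suc k) (E-scale 1 (E[5k,5k-2] k)) }
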